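{- Let $d \ge 1$ and $n_1, \dots, n_d$ be positive integers, let $X = [n_1]\times\dotsb\times[n_d]$, and let $\sigma$ be a permutation of $X$. Then there exist permutations $\sigma_1, \dots, \sigma_{2d-1}$ of $X$ such that \[ \sigma = \sigma_{2d-1} \circ \dotsb \circ \sigma_1, \] where, for each $i \in \{1, \dots, 2d-1\}$, the permutation $\sigma_i$ is one-dimensional in direction $j_i = \lvert d - i\rvert + 1$.
   Context: For a positive integer $n$, $[n] = \{1, \dots, n\}$. A permutation $\tau$ of $X = [n_1]\times\dotsb\times[n_d]$ is called one-dimensional in direction $j \in [d]$ if for every $x \in X$, the vectors $\tau(x)$ and $x$ agree in every coordinate other than (possibly) coordinate $j$. -}

module Defs where

open import Data.Nat using (ℕ; zero; suc; _+_; _∸_; NonZero)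
open import Data.Fin using (Fin; toℕ; fromℕ<)
open import Data.Vec.Functional using (Vector)
open import Relation.Binary.PropositionalEquality using (_≡_)
open import Relation.Binary.Bundles using (Setoid)
open import Function.Bundles using (Inverse)
open import Relation.Binary.Structures using (IsEquivalence)
open import Relation.Binary.PropositionalEquality as P using ()
open import Level using (0ℓ)
open import Relation.Nullary using (¬_)

-- The grid X = [n_1] × ... × [n_d]; coordinates are 0-based (Fin (n j)),
-- directions are 0-based (Fin d).
Point : (d : ℕ) → (Fin d → ℕ) → Set
Point d n = (j : Fin d) → Fin (n j)

_≈ᴾ_ : ∀ {d n} → Point d n → Point d n → Set
x ≈ᴾ y = ∀ j → x j ≡ y j

PointSetoid : (d : ℕ) → (Fin d → ℕ) → Setoid 0ℓ 0ℓ
PointSetoid d n = record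
  { Carrier = Point d n
  ; _≈_ = _≈ᴾ_
  ; isEquivalence = record
    { refl = λ j → P.refl
    ; sym = λ p j → P.sym (p j)
    ; trans = λ p q j → P.trans (p j) (q j)
    }
  }

Perm : (d : ℕ) → (Fin d → ℕ) → Set
Perm d n = Inverse (PointSetoid d n) (PointSetoid d n)

app : ∀ {d n} → Perm d n → Point d n → Point d n
app σ = Inverse.to σ

OneDimensional : ∀ {d n} → Perm d n → Fin d → Set
OneDimensional {d} τ j = ∀ x (k : Fin d) → ¬ (k ≡ j) → app τ x k ≡ x k

-- Apply σ_1, then σ_2, ..., then σ_m  (i.e. σ_m ∘ ... ∘ σ_1), where the
-- family is indexed by Fin m with index i (0-based) standing for σ_{i+1}.
applyAll : ∀ {d n} (m : ℕ) → (Fin m → Perm d n) → Point d n → Point d n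
applyAll zero σs x = x
applyAll (suc m) σs x = applyAll m (λ i → σs (Data.Fin.suc i)) (app (σs Data.Fin.zero) x)
  where import Data.Fin

dist : ℕ → ℕ → ℕ
dist a b = (a ∸ b) + (b ∸ a)

-- Split off the last coordinate, X = Y × [n_d], and enumerate Y, so that σ becomes a permutation π of the
-- cells (a , c) of a grid with columns a ∈ Y and heights c ∈ [n_d].  Taking each cell as an edge from its
-- column to the column of its image gives an n_d-regular bipartite multigraph, which by König's theorem
-- (proved with Kempe chains) has a proper edge colouring with n_d colours.  Moving every cell within its
-- column to the height given by its colour, then every colour class to the image columns, then within the
-- columns to the final heights, writes π = τ₂ ∘ ρ ∘ τ₁ with τ₁, τ₂ one-dimensional in direction d and ρ
-- preserving heights.  On each slice Y × {c}, ρ is a permutation of Y and by induction a product of 2d − 3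
-- one-dimensional permutations in directions d − 1, …, 1, …, d − 1; performing these on all slices at once
-- yields the 2d − 1 factors.

module Submission where

open import Defs

open import Data.Bool using (if_then_else_)
open import Data.Empty using (⊥-elim)
open import Data.Fin
  using (Fin; zero; suc; toℕ; fromℕ; fromℕ<; inject₁; punchOut; remQuot; combine; splitAt; cast; _↑ʳ_)
open import Data.Fin.Permutation using (Permutation′; _⟨$⟩ʳ_; _⟨$⟩ˡ_; inverseˡ; inverseʳ)
open import Data.Fin.Properties
  using ( _≟_; any?; ¬∀⟶∃¬; ¬Fin0; 0≢1+n; suc-injective; injective⇒≤; punchOut-injective
        ; toℕ-injective; toℕ≤pred[n]; toℕ-fromℕ; toℕ-fromℕ<; toℕ-inject₁; toℕ-cast; toℕ-↑ˡ; toℕ-↑ʳ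
        ; cast-is-id; remQuot-combine; combine-remQuot; splitAt⁻¹-↑ˡ; splitAt⁻¹-↑ʳ)
open import Data.Fin.Relation.Unary.Top using (View; ‵fromℕ; ‵inject₁; view; view-fromℕ; view-inject₁)
open import Data.Nat using (ℕ; zero; suc; _+_; _∸_; _*_; _≤_; _<_; _≤′_; ≤′-refl; ≤′-step)
open import Data.Nat.Properties
  using (≤⇒≤′; 1+n≰n; m≤m+n; m≤n⇒m∸n≡0; m+n∸m≡n; +-assoc; +-comm; +-identityʳ)
open import Data.Product using (Σ; ∃; ∃₂; _×_; _,_; proj₁; proj₂; uncurry)
open import Data.Product.Properties using (×-≡,≡→≡)
open import Data.Sum using (_⊎_; inj₁; inj₂)
open import Data.Sum.Properties using ([,]-map)
open import Data.Vec.Functional using (Vector; _∷_; []; _++_; map)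
open import Data.Vec.Functional.Relation.Binary.Pointwise using (Pointwise)
open import Data.Vec.Functional.Relation.Binary.Pointwise.Properties using (++⁺)
open import Function using (_∘_; flip)
open import Function.Bundles using (Inverse; Injection; _↔_; mk↔ₛ′; mk⤖)
import Function.Construct.Composition as Compose
import Function.Construct.Symmetry as Symmetry
open import Function.Definitions using (Injective)
open import Function.Properties.Bijection using (⤖⇒↔)
open import Function.Properties.Inverse using (Inverse⇒Injection)
open import Level using (0ℓ)
open import Relation.Binary.Bundles using (Setoid)
open import Relation.Binary.Core using (Rel)
open import Relation.Binary.Definitions using (Decidable)
open import Relation.Binary.PropositionalEquality
  using (_≡_; _≢_; refl; sym; trans; cong; cong₂; subst; setoid; module ≡-Reasoning)
open import Relation.Nullary using (¬_; yes; no; does)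
open import Relation.Nullary.Decidable using (_×-dec_; map′)
open import Relation.Nullary.Negation using (contradiction)
import Relation.Unary as U

open ≡-Reasoning

injective⇒surjective : ∀ {q} {f : Fin q → Fin q} → Injective _≡_ _≡_ f → ∀ y → ∃ λ x → f x ≡ y
injective⇒surjective {suc q} {f} f-injective y with any? (λ x → f x ≟ y)
... | yes hit = hit
... | no miss = contradiction (injective⇒≤ avoid-injective) 1+n≰n
  where
  avoid : Fin (suc q) → Fin q
  avoid x = punchOut {i = y} (miss ∘ (x ,_) ∘ sym)
  avoid-injective : Injective _≡_ _≡_ avoid
  avoid-injective {x} {x′} =
    f-injective ∘ punchOut-injective {i = y} (miss ∘ (x ,_) ∘ sym) (miss ∘ (x′ ,_) ∘ sym)

injective⇒permutation : ∀ {q} (f : Fin q → Fin q) → Injective _≡_ _≡_ f → Permutation′ q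
injective⇒permutation f f-injective = ⤖⇒↔ (mk⤖ (f-injective , surjective))
  where
  surjective : ∀ y → ∃ λ x → ∀ {z} → z ≡ x → f z ≡ y
  surjective y with x , fx≡y ← injective⇒surjective f-injective y = x , λ { refl → fx≡y }

module Reachability {p} (_⟶_ : Rel (Fin p) 0ℓ) (_⟶?_ : Decidable _⟶_)
  (⟶-injective : ∀ {w₁ w₂ z} → w₁ ⟶ z → w₂ ⟶ z → w₁ ≡ w₂)
  (v : Fin p) (v-source : ∀ {w} → ¬ (w ⟶ v)) where

  ReachIn : ℕ → Fin p → Set
  ReachIn zero w = w ≡ v
  ReachIn (suc j) w = ∃ λ w′ → ReachIn j w′ × w′ ⟶ w

  reachIn? : ∀ j → U.Decidable (ReachIn j)
  reachIn? zero w = w ≟ v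
  reachIn? (suc j) w = any? λ w′ → reachIn? j w′ ×-dec w′ ⟶? w

  reachIn-unique : ∀ {i j z} → ReachIn i z → ReachIn j z → i ≡ j
  reachIn-unique {zero} {zero} _ _ = refl
  reachIn-unique {zero} {suc j} refl (_ , _ , w⟶v) = ⊥-elim (v-source w⟶v)
  reachIn-unique {suc i} {zero} (_ , _ , w⟶v) refl = ⊥-elim (v-source w⟶v)
  reachIn-unique {suc i} {suc j} (_ , r₁ , s₁) (_ , r₂ , s₂) with refl ← ⟶-injective s₁ s₂ =
    cong suc (reachIn-unique r₁ r₂)

  reachIn-earlier : ∀ {i j w} → i ≤′ j → ReachIn j w → ∃ (ReachIn i)
  reachIn-earlier ≤′-refl r = _ , r
  reachIn-earlier (≤′-step i≤′j) (_ , r , _) = reachIn-earlier i≤′j r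

  reachIn-bounded : ∀ {j w} → ReachIn j w → j < p
  reachIn-bounded {j} r = injective⇒≤ stage-injective
    where
    earlier : (i : Fin (suc j)) → ∃ (ReachIn (toℕ i))
    earlier i = reachIn-earlier (≤⇒≤′ (toℕ≤pred[n] i)) r
    stage : Fin (suc j) → Fin p
    stage = proj₁ ∘ earlier
    stage-injective : Injective _≡_ _≡_ stage
    stage-injective {i} {i′} eq =
      toℕ-injective (reachIn-unique (proj₂ (earlier i)) (subst (ReachIn _) (sym eq) (proj₂ (earlier i′))))

  Reachable : Fin p → Set
  Reachable w = ∃ λ j → ReachIn j w

  reachable-step : ∀ {w w′} → Reachable w → w ⟶ w′ → Reachable w′
  reachable-step (j , r) w⟶w′ = suc j , _ , r , w⟶w′

  reachable? : U.Decidable Reachable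
  reachable? w = map′ (λ (j , r) → toℕ j , r) bounded (any? λ j → reachIn? (toℕ j) w)
    where
    bounded : Reachable w → ∃ λ (j : Fin p) → ReachIn (toℕ j) w
    bounded (j , r) = fromℕ< (reachIn-bounded r) , subst (λ k → ReachIn k w) (sym (toℕ-fromℕ< _)) r

-- König's edge-colouring theorem

private
  variable
    Edge Edge′ V C : Set

Proper : (Edge → V) → (Edge → C) → Set
Proper end colour = ∀ {x y} → end x ≡ end y → colour x ≡ colour y → x ≡ y

Missing : (Edge → V) → (Edge → C) → V → C → Set
Missing end colour w c = ∀ {x} → end x ≡ w → colour x ≢ c

Proper-∘ : ∀ {end : Edge → V} {colour : Edge → C} {f : Edge′ → Edge} → Injective _≡_ _≡_ f →
           Proper end colour → Proper (end ∘ f) (colour ∘ f)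
Proper-∘ f-injective proper e c = f-injective (proper e c)

Proper-resp : ∀ {end end′ : Edge → V} {colour : Edge → C} → (∀ x → end x ≡ end′ x) →
              Proper end colour → Proper end′ colour
Proper-resp end≗end′ proper e = proper (trans (end≗end′ _) (trans e (sym (end≗end′ _))))

module _ {N p q} {end : Fin (suc N) → Fin p} {ℓ : Fin (suc N) → Fin q} (ℓ-proper : Proper end ℓ)
         (colour : Fin N → Fin q) where

  private
    UsedAt₀ : Fin q → Set
    UsedAt₀ c = ∃ λ x → end (suc x) ≡ end zero × colour x ≡ c

    usedAt₀? : U.Decidable UsedAt₀
    usedAt₀? c = any? λ x → (end (suc x) ≟ end zero) ×-dec (colour x ≟ c)

    -- Otherwise ℓ would give q + 1 edges at end zero distinct labels.
    ¬all-usedAt₀ : ¬ (∀ c → UsedAt₀ c)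
    ¬all-usedAt₀ used =
      let c , label≡ℓ₀ = injective⇒surjective label-injective (ℓ zero)
      in 0≢1+n (sym (ℓ-proper (proj₁ (proj₂ (used c))) label≡ℓ₀))
      where
      label : Fin q → Fin q
      label c = ℓ (suc (proj₁ (used c)))
      label-injective : Injective _≡_ _≡_ label
      label-injective {c} {c′} eq with used c | used c′
      ... | x , e , refl | x′ , e′ , refl = cong colour (suc-injective (ℓ-proper (trans e (sym e′)) eq))

  missing-colour : ∃ (Missing (end ∘ suc) colour (end zero))
  missing-colour with c , unused ← ¬∀⟶∃¬ _ UsedAt₀ usedAt₀? ¬all-usedAt₀ = c , λ e eq → unused (_ , e , eq)

extend-proper : ∀ {N q} {end : Fin (suc N) → V} {colour : Fin N → Fin q} {α} →
                Proper (end ∘ suc) colour → Missing (end ∘ suc) colour (end zero) α →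
                Proper end (α ∷ colour)
extend-proper proper missing {zero} {zero} _ _ = refl
extend-proper proper missing {zero} {suc y} e c = ⊥-elim (missing (sym e) (sym c))
extend-proper proper missing {suc x} {zero} e c = ⊥-elim (missing e c)
extend-proper proper missing {suc x} {suc y} e c = cong suc (proper e c)

module Transposition {q} (α β : Fin q) where

  swap : Fin q → Fin q
  swap c = if does (c ≟ α) then β else if does (c ≟ β) then α else c

  swap-cases : ∀ c → c ≡ α × swap c ≡ β ⊎ c ≡ β × swap c ≡ α ⊎ c ≢ α × c ≢ β × swap c ≡ c
  swap-cases c with c ≟ α | c ≟ β
  ... | yes c≡α | _ = inj₁ (c≡α , refl)
  ... | no _ | yes c≡β = inj₂ (inj₁ (c≡β , refl))
  ... | no c≢α | no c≢β = inj₂ (inj₂ (c≢α , c≢β , refl))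

  swap-α : swap α ≡ β
  swap-α with α ≟ α
  ... | yes _ = refl
  ... | no α≢α = contradiction refl α≢α

  swap-β : swap β ≡ α
  swap-β with β ≟ α | β ≟ β
  ... | yes β≡α | _ = β≡α
  ... | no _ | yes _ = refl
  ... | no _ | no β≢β = contradiction refl β≢β

  swap-involutive : ∀ c → swap (swap c) ≡ c
  swap-involutive c with swap-cases c
  ... | inj₁ (refl , e) = trans (cong swap e) swap-β
  ... | inj₂ (inj₁ (refl , e)) = trans (cong swap e) swap-α
  ... | inj₂ (inj₂ (_ , _ , e)) = trans (cong swap e) e

  swap-injective : Injective _≡_ _≡_ swap
  swap-injective {c} {c′} e = trans (sym (swap-involutive c)) (trans (cong swap e) (swap-involutive c′))

  swap≡α⇒β : ∀ {c} → swap c ≡ α → c ≡ β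
  swap≡α⇒β {c} e = trans (sym (swap-involutive c)) (trans (cong swap e) swap-α)

module KempeSwitch {N p r q} (s : Fin N → Fin p) (t : Fin N → Fin r) (colour : Fin N → Fin q)
  (s-proper : Proper s colour) (t-proper : Proper t colour)
  {α β : Fin q} {u : Fin p} {v : Fin r}
  (α-missing : Missing s colour u α) (β-missing : Missing t colour v β) where

  open Transposition α β

  -- One step along the α/β Kempe chain from v: an α-edge to the left side, then a β-edge back.
  _⟶_ : Rel (Fin r) 0ℓ
  w ⟶ w′ = ∃₂ λ x y → t x ≡ w × colour x ≡ α × s y ≡ s x × colour y ≡ β × t y ≡ w′

  _⟶?_ : Decidable _⟶_
  w ⟶? w′ = any? λ x → any? λ y →
    t x ≟ w ×-dec colour x ≟ α ×-dec s y ≟ s x ×-dec colour y ≟ β ×-dec t y ≟ w′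

  ⟶-injective : ∀ {w₁ w₂ z} → w₁ ⟶ z → w₂ ⟶ z → w₁ ≡ w₂
  ⟶-injective (_ , _ , refl , cx₁ , sy₁ , cy₁ , ty₁) (_ , _ , refl , cx₂ , sy₂ , cy₂ , ty₂)
    with refl ← t-proper (trans ty₁ (sym ty₂)) (trans cy₁ (sym cy₂))
    with refl ← s-proper (trans (sym sy₁) sy₂) (trans cx₁ (sym cx₂)) = refl

  v-source : ∀ {w} → ¬ (w ⟶ v)
  v-source (_ , _ , _ , _ , _ , cy , ty) = β-missing ty cy

  open Reachability _⟶_ _⟶?_ ⟶-injective v v-source

  α-partner : ∀ {y} → Reachable (t y) → colour y ≡ β →
              ∃ λ z → s z ≡ s y × colour z ≡ α × Reachable (t z)
  α-partner (zero , ty≡v) cy = ⊥-elim (β-missing ty≡v cy)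
  α-partner (suc j , _ , r , x , _ , tx≡w , cx , sy′ , cy′ , ty′) cy
    with refl ← t-proper ty′ (trans cy′ (sym cy)) = x , sym sy′ , cx , j , subst (ReachIn j) (sym tx≡w) r

  -- Swapping α and β on all edges ending on the chain frees α at v; α stays free at u since
  -- the chain reaches left vertices only along α-edges (α-partner).
  recolour : Fin N → Fin q
  recolour x with reachable? (t x)
  ... | yes _ = swap (colour x)
  ... | no _ = colour x

  data Recoloured (x : Fin N) : Fin q → Set where
    swapped : Reachable (t x) → Recoloured x (swap (colour x))
    kept : ¬ Reachable (t x) → Recoloured x (colour x)

  recoloured : ∀ x → Recoloured x (recolour x)
  recoloured x with reachable? (t x)
  ... | yes on = swapped on
  ... | no off = kept off

  chain-closed : ∀ {x y} → s x ≡ s y → Reachable (t x) → ¬ Reachable (t y) → swap (colour x) ≢ colour y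
  chain-closed {x} {y} sx≡sy on off c with swap-cases (colour x)
  ... | inj₁ (cx≡α , swap≡β) =
    off (reachable-step on (x , y , refl , cx≡α , sym sx≡sy , trans (sym c) swap≡β , refl))
  ... | inj₂ (inj₁ (cx≡β , swap≡α)) with z , sz≡sx , cz≡α , on-z ← α-partner on cx≡β
    with refl ← s-proper (trans sz≡sx sx≡sy) (trans cz≡α (trans (sym swap≡α) c)) = off on-z
  ... | inj₂ (inj₂ (_ , _ , swap≡id)) with refl ← s-proper sx≡sy (trans (sym swap≡id) c) = off on

  recolour-s-proper : Proper s recolour
  recolour-s-proper {x} {y} sx≡sy c with recolour x | recoloured x | recolour y | recoloured y
  ... | _ | swapped _ | _ | swapped _ = s-proper sx≡sy (swap-injective c)
  ... | _ | kept _ | _ | kept _ = s-proper sx≡sy c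
  ... | _ | swapped on | _ | kept off = ⊥-elim (chain-closed sx≡sy on off c)
  ... | _ | kept off | _ | swapped on = ⊥-elim (chain-closed (sym sx≡sy) on off (sym c))

  recolour-t-proper : Proper t recolour
  recolour-t-proper {x} {y} tx≡ty c with recolour x | recoloured x | recolour y | recoloured y
  ... | _ | swapped _ | _ | swapped _ = t-proper tx≡ty (swap-injective c)
  ... | _ | kept _ | _ | kept _ = t-proper tx≡ty c
  ... | _ | swapped on | _ | kept off = ⊥-elim (off (subst Reachable tx≡ty on))
  ... | _ | kept off | _ | swapped on = ⊥-elim (off (subst Reachable (sym tx≡ty) on))

  recolour-missing-u : Missing s recolour u α
  recolour-missing-u {x} sx≡u c with recolour x | recoloured x
  ... | _ | kept _ = α-missing sx≡u c
  ... | _ | swapped on with z , sz≡sx , cz≡α , _ ← α-partner on (swap≡α⇒β c) = α-missing (trans sz≡sx sx≡u) cz≡α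

  recolour-missing-v : Missing t recolour v α
  recolour-missing-v {x} tx≡v c with recolour x | recoloured x
  ... | _ | swapped _ = β-missing tx≡v (swap≡α⇒β c)
  ... | _ | kept off = off (zero , tx≡v)

-- The labellings ℓ and ℓ′ witness that every vertex has degree at most q.
edge-colouring : ∀ {N p r q} (s : Fin N → Fin p) (t : Fin N → Fin r) {ℓ ℓ′ : Fin N → Fin q} →
                 Proper s ℓ → Proper t ℓ′ → ∃ λ (colour : Fin N → Fin q) → Proper s colour × Proper t colour
edge-colouring {zero} s t _ _ = (λ ()) , (λ {x} → ⊥-elim (¬Fin0 x)) , (λ {x} → ⊥-elim (¬Fin0 x))
edge-colouring {suc N} s t {ℓ} {ℓ′} ℓ-proper ℓ′-proper
  with colour , s-proper , t-proper ← edge-colouring (s ∘ suc) (t ∘ suc)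
         (Proper-∘ {colour = ℓ} suc-injective ℓ-proper) (Proper-∘ {colour = ℓ′} suc-injective ℓ′-proper)
  with α , α-missing ← missing-colour ℓ-proper colour
  with β , β-missing ← missing-colour ℓ′-proper colour =
  α ∷ recolour ,
  extend-proper recolour-s-proper recolour-missing-u ,
  extend-proper recolour-t-proper recolour-missing-v
  where open KempeSwitch (s ∘ suc) (t ∘ suc) colour s-proper t-proper α-missing β-missing

-- Column–row–column factorisation of a grid permutation

injective⇒proper : ∀ {f : Edge → V × C} → Injective _≡_ _≡_ f → Proper (proj₁ ∘ f) (proj₂ ∘ f)
injective⇒proper f-injective e c = f-injective (×-≡,≡→≡ (e , c))

module _ {p q : ℕ} where

  columnwise : (Fin p → Permutation′ q) → (Fin p × Fin q) ↔ (Fin p × Fin q)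
  columnwise α = mk↔ₛ′ (λ (a , b) → a , α a ⟨$⟩ʳ b) (λ (a , b) → a , α a ⟨$⟩ˡ b)
    (λ (a , b) → cong (a ,_) (inverseʳ (α a))) (λ (a , b) → cong (a ,_) (inverseˡ (α a)))

  rowwise : (Fin q → Permutation′ p) → (Fin p × Fin q) ↔ (Fin p × Fin q)
  rowwise β = mk↔ₛ′ (λ (a , b) → β b ⟨$⟩ʳ a , b) (λ (a , b) → β b ⟨$⟩ˡ a , b)
    (λ (a , b) → cong (_, b) (inverseʳ (β b))) (λ (a , b) → cong (_, b) (inverseˡ (β b)))

  private
    cell : Fin (p * q) → Fin p × Fin q
    cell = remQuot {p} q

    index : Fin p × Fin q → Fin (p * q)
    index = uncurry combine

    cell-index : ∀ x → cell (index x) ≡ x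
    cell-index (a , b) = remQuot-combine a b

    cell-injective : Injective _≡_ _≡_ cell
    cell-injective {i} {j} e =
      trans (sym (combine-remQuot {p} q i)) (trans (cong index e) (combine-remQuot {p} q j))

    index-injective : Injective _≡_ _≡_ index
    index-injective {x} {y} e = trans (sym (cell-index x)) (trans (cong cell e) (cell-index y))

  -- Cells are edges from their column to the column of their image under π.
  cell-colouring : (π : Fin p × Fin q → Fin p × Fin q) → Injective _≡_ _≡_ π →
                   ∃ λ (κ : Fin p × Fin q → Fin q) → Proper proj₁ κ × Proper (proj₁ ∘ π) κ
  cell-colouring π π-injective
    with colour , column-proper , image-proper ← edge-colouring (proj₁ ∘ cell) (proj₁ ∘ π ∘ cell)
           (injective⇒proper cell-injective) (injective⇒proper (cell-injective ∘ π-injective)) =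
    colour ∘ index ,
    Proper-resp (cong proj₁ ∘ cell-index) (Proper-∘ index-injective column-proper) ,
    Proper-resp (cong (proj₁ ∘ π) ∘ cell-index) (Proper-∘ index-injective image-proper)

  record ColumnRowColumn (π : Fin p × Fin q → Fin p × Fin q) : Set where
    field
      columns₁ columns₂ : Fin p → Permutation′ q
      rows : Fin q → Permutation′ p
      factorises : ∀ x → π x ≡ Inverse.to (columnwise columns₂)
                                 (Inverse.to (rowwise rows) (Inverse.to (columnwise columns₁) x))

  -- Opaque: unfolding the colouring during later conversion checks is prohibitively slow.
  opaque
    column-row-column : (π : Fin p × Fin q → Fin p × Fin q) → Injective _≡_ _≡_ π → ColumnRowColumn π
    column-row-column π π-injective with κ , κ-column , κ-image ← cell-colouring π π-injective =
      record { columns₁ = α ; columns₂ = α′ ; rows = β ; factorises = factorises }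
      where
      α : Fin p → Permutation′ q
      α a = injective⇒permutation (λ b → κ (a , b)) (cong proj₂ ∘ κ-column refl)

      cellOf : Fin p → Fin q → Fin p × Fin q
      cellOf a c = a , α a ⟨$⟩ˡ c

      κ-cellOf : ∀ {a} c → κ (cellOf a c) ≡ c
      κ-cellOf {a} c = inverseʳ (α a)

      β : Fin q → Permutation′ p
      β c = injective⇒permutation (λ a → proj₁ (π (cellOf a c)))
        λ e → cong proj₁ (κ-image e (trans (κ-cellOf c) (sym (κ-cellOf c))))

      α′ : Fin p → Permutation′ q
      α′ a′ = injective⇒permutation (λ c → proj₂ (π (cellOf (β c ⟨$⟩ˡ a′) c))) λ {c} {c′} e →
        let same-image = ×-≡,≡→≡ (trans (inverseʳ (β c)) (sym (inverseʳ (β c′))) , e)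
        in trans (sym (κ-cellOf c)) (trans (cong κ (π-injective same-image)) (κ-cellOf c′))

      factorises : ∀ x → π x ≡ Inverse.to (columnwise α′)
                                 (Inverse.to (rowwise β) (Inverse.to (columnwise α) x))
      factorises (a , b) = begin
        π (a , b)
          ≡⟨ cong (π ∘ (a ,_)) (sym (inverseˡ (α a))) ⟩
        π (cellOf a c)
          ≡⟨ cong (λ a₀ → a′ , proj₂ (π (cellOf a₀ c))) (sym (inverseˡ (β c))) ⟩
        a′ , proj₂ (π (cellOf (β c ⟨$⟩ˡ a′) c))
          ∎
        where
        c : Fin q
        c = κ (a , b)
        a′ : Fin p
        a′ = proj₁ (π (cellOf a c))

size : (d : ℕ) → (Fin d → ℕ) → ℕ
size zero n = 1
size (suc d) n = n zero * size d (n ∘ suc)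

module _ {d : ℕ} {n : Fin d → ℕ} where

  ≈ᴾ-refl : {x : Point d n} → x ≈ᴾ x
  ≈ᴾ-refl = Setoid.refl (PointSetoid d n)

  ≈ᴾ-sym : {x y : Point d n} → x ≈ᴾ y → y ≈ᴾ x
  ≈ᴾ-sym = Setoid.sym (PointSetoid d n)

  ≈ᴾ-trans : {x y z : Point d n} → x ≈ᴾ y → y ≈ᴾ z → x ≈ᴾ z
  ≈ᴾ-trans = Setoid.trans (PointSetoid d n)

encode : ∀ {d n} → Point d n → Fin (size d n)
encode {zero} x = zero
encode {suc d} x = combine (x zero) (encode (x ∘ suc))

private
  split : ∀ d n → Fin (size (suc d) n) → Fin (n zero) × Fin (size d (n ∘ suc))
  split d n = remQuot {n zero} (size d (n ∘ suc))

decode : ∀ {d n} → Fin (size d n) → Point d n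
decode {suc d} {n} i zero = proj₁ (split d n i)
decode {suc d} {n} i (suc j) = decode (proj₂ (split d n i)) j

encode-cong : ∀ {d n} {x y : Point d n} → x ≈ᴾ y → encode x ≡ encode y
encode-cong {zero} _ = refl
encode-cong {suc d} x≈y = cong₂ combine (x≈y zero) (encode-cong (x≈y ∘ suc))

encode-decode : ∀ {d n} (i : Fin (size d n)) → encode {d} {n} (decode i) ≡ i
encode-decode {zero} zero = refl
encode-decode {suc d} {n} i =
  trans (cong (combine (proj₁ (split d n i))) (encode-decode {d} {n ∘ suc} (proj₂ (split d n i))))
        (combine-remQuot {n zero} (size d (n ∘ suc)) i)

decode-encode : ∀ {d n} (x : Point d n) → decode (encode x) ≈ᴾ x
decode-encode {suc d} {n} x zero = cong proj₁ (remQuot-combine {n zero} (x zero) (encode (x ∘ suc)))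
decode-encode {suc d} {n} x (suc j) =
  trans (cong (λ i → decode i j) (cong proj₂ (remQuot-combine {n zero} (x zero) (encode (x ∘ suc)))))
        (decode-encode (x ∘ suc) j)

enumeration : ∀ {d n} → Inverse (PointSetoid d n) (setoid (Fin (size d n)))
enumeration {d} {n} = record
  { to = encode ; from = decode ; to-cong = encode-cong ; from-cong = λ { refl _ → refl }
  ; inverse = strictlyInverseˡ⇒inverseˡ {f⁻¹ = decode} encode-cong (encode-decode {d} {n})
            , strictlyInverseʳ⇒inverseʳ {f = encode} (λ { refl _ → refl }) decode-encode }
  where open import Function.Consequences.Setoid (PointSetoid d n) (setoid (Fin (size d n)))

conjugate : ∀ {a ℓ₁ b ℓ₂} {S : Setoid a ℓ₁} {T : Setoid b ℓ₂} → Inverse S T → Inverse T T → Inverse S S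
conjugate E τ = Compose.inverse (Compose.inverse E τ) (Symmetry.inverse E)

to-injective : ∀ {a ℓ₁ b ℓ₂} {S : Setoid a ℓ₁} {T : Setoid b ℓ₂} (E : Inverse S T) →
               Injective (Setoid._≈_ S) (Setoid._≈_ T) (Inverse.to E)
to-injective E = Injection.injective (Inverse⇒Injection E)

module _ {m : ℕ} {n : Fin (suc m) → ℕ} where

  init : Point (suc m) n → Point m (n ∘ inject₁)
  init x = x ∘ inject₁

  last : Point (suc m) n → Fin (n (fromℕ m))
  last x = x (fromℕ m)

  private
    snocAt : Point m (n ∘ inject₁) → Fin (n (fromℕ m)) → ∀ {i} → View i → Fin (n i)
    snocAt y c ‵fromℕ = c
    snocAt y c (‵inject₁ j) = y j

  snoc : Point m (n ∘ inject₁) → Fin (n (fromℕ m)) → Point (suc m) n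
  snoc y c i = snocAt y c (view i)

  last-snoc : ∀ y c → last (snoc y c) ≡ c
  last-snoc y c = cong (snocAt y c) (view-fromℕ m)

  init-snoc : ∀ y c → init (snoc y c) ≈ᴾ y
  init-snoc y c j = cong (snocAt y c) (view-inject₁ j)

  snoc-cong : ∀ {y y′} c → y ≈ᴾ y′ → snoc y c ≈ᴾ snoc y′ c
  snoc-cong c y≈y′ i = go (view i)
    where
    go : ∀ {i} (v : View i) → snocAt _ c v ≡ snocAt _ c v
    go ‵fromℕ = refl
    go (‵inject₁ j) = y≈y′ j

  snoc-init-last : ∀ x → snoc (init x) (last x) ≈ᴾ x
  snoc-init-last x i = go (view i)
    where
    go : ∀ {i} (v : View i) → snocAt (init x) (last x) v ≡ x i
    go ‵fromℕ = refl
    go (‵inject₁ j) = refl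

  Cell : Set
  Cell = Fin (size m (n ∘ inject₁)) × Fin (n (fromℕ m))

  splitLast : Inverse (PointSetoid (suc m) n) (setoid Cell)
  splitLast = record
    { to = to ; from = from ; to-cong = to-cong ; from-cong = from-cong
    ; inverse = strictlyInverseˡ⇒inverseˡ {f⁻¹ = from} to-cong to-from
              , strictlyInverseʳ⇒inverseʳ {f = to} from-cong from-to }
    where
    open import Function.Consequences.Setoid (PointSetoid (suc m) n) (setoid Cell)
    to : Point (suc m) n → Cell
    to x = encode (init x) , last x
    from : Cell → Point (suc m) n
    from (a , c) = snoc (decode a) c
    to-cong : ∀ {x y} → x ≈ᴾ y → to x ≡ to y
    to-cong x≈y = cong₂ _,_ (encode-cong (x≈y ∘ inject₁)) (x≈y (fromℕ m))
    from-cong : ∀ {z z′} → z ≡ z′ → from z ≈ᴾ from z′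
    from-cong refl _ = refl
    to-from : ∀ z → to (from z) ≡ z
    to-from (a , c) =
      cong₂ _,_ (trans (encode-cong (init-snoc (decode a) c)) (encode-decode {m} {n ∘ inject₁} a)) (last-snoc _ c)
    from-to : ∀ x → from (to x) ≈ᴾ x
    from-to x = ≈ᴾ-trans (snoc-cong (last x) (decode-encode (init x))) (snoc-init-last x)

module _ {d : ℕ} {n : Fin d → ℕ} where

  applyAll-cong : ∀ L (fs : Vector (Perm d n) L) {x y} → x ≈ᴾ y → applyAll L fs x ≈ᴾ applyAll L fs y
  applyAll-cong zero fs x≈y = x≈y
  applyAll-cong (suc L) fs x≈y = applyAll-cong L (fs ∘ suc) (Inverse.to-cong (fs zero) x≈y)

  applyAll-≗ : ∀ L {fs gs : Vector (Perm d n) L} → (∀ i → fs i ≡ gs i) → ∀ x → applyAll L fs x ≡ applyAll L gs x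
  applyAll-≗ zero fs≗gs x = refl
  applyAll-≗ (suc L) {fs} {gs} fs≗gs x =
    trans (cong (applyAll L (fs ∘ suc) ∘ flip app x) (fs≗gs zero)) (applyAll-≗ L (fs≗gs ∘ suc) _)

  applyAll-++ : ∀ a {b} (fs : Vector (Perm d n) a) (gs : Vector (Perm d n) b) x →
                applyAll (a + b) (fs ++ gs) x ≡ applyAll b gs (applyAll a fs x)
  applyAll-++ zero fs gs x = refl
  applyAll-++ (suc a) {b} fs gs x =
    trans (applyAll-≗ (a + b) ([,]-map ∘ splitAt a) _) (applyAll-++ a (fs ∘ suc) gs _)

  applyAll-cast : ∀ {L L′} (eq : L′ ≡ L) (fs : Vector (Perm d n) L) x →
                  applyAll L′ (fs ∘ cast eq) x ≡ applyAll L fs x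
  applyAll-cast refl fs = applyAll-≗ _ (cong fs ∘ cast-is-id refl)

module GridFactors {m : ℕ} (n : Fin (suc m) → ℕ) where

  open Inverse (splitLast {m} {n}) using (to; from; strictlyInverseˡ)

  columnFactor : (Fin (size m (n ∘ inject₁)) → Permutation′ (n (fromℕ m))) → Perm (suc m) n
  columnFactor α = conjugate splitLast (columnwise α)

  rowFactor : (Fin (n (fromℕ m)) → Perm m (n ∘ inject₁)) → Perm (suc m) n
  rowFactor ρ = conjugate splitLast (rowwise λ c → conjugate (Symmetry.inverse enumeration) (ρ c))

  columnFactor-oneDimensional : ∀ α → OneDimensional (columnFactor α) (fromℕ m)
  columnFactor-oneDimensional α x k k≢last with view k
  ... | ‵fromℕ = contradiction refl k≢last
  ... | ‵inject₁ j = decode-encode (init x) j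

  rowFactor-oneDimensional : ∀ ρ {j} → (∀ c → OneDimensional (ρ c) j) → OneDimensional (rowFactor ρ) (inject₁ j)
  rowFactor-oneDimensional ρ ρ-oneDimensional x k k≢j with view k
  ... | ‵fromℕ = refl
  ... | ‵inject₁ k′ = begin
    decode (encode (app ρₓ y)) k′                            ≡⟨ decode-encode (app ρₓ y) k′ ⟩
    app ρₓ y k′                                              ≡⟨ ρ-oneDimensional (last x) y k′ (k≢j ∘ cong inject₁) ⟩
    y k′                                                     ≡⟨ decode-encode (init x) k′ ⟩
    x (inject₁ k′)                                           ∎
    where
    ρₓ : Perm m (n ∘ inject₁)
    ρₓ = ρ (last x)
    y : Point m (n ∘ inject₁)
    y = decode (encode (init x))

  applyAll-rowFactor : ∀ L (ρs : Fin (n (fromℕ m)) → Vector (Perm m (n ∘ inject₁)) L) a c →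
    to (applyAll L (λ i → rowFactor (λ c → ρs c i)) (from (a , c))) ≡ (encode (applyAll L (ρs c) (decode a)) , c)
  applyAll-rowFactor zero ρs a c =
    trans (strictlyInverseˡ (a , c)) (cong (_, c) (sym (encode-decode {m} {n ∘ inject₁} a)))
  applyAll-rowFactor (suc L) ρs a c = begin
    to (applyAll L rest (from (Inverse.to row (to (from (a , c))))))
      ≡⟨ cong (λ z → to (applyAll L rest (from (Inverse.to row z)))) (strictlyInverseˡ (a , c)) ⟩
    to (applyAll L rest (from (encode y , c)))
      ≡⟨ applyAll-rowFactor L (λ c → ρs c ∘ suc) (encode y) c ⟩
    encode (applyAll L (ρs c ∘ suc) (decode (encode y))) , c
      ≡⟨ cong (_, c) (encode-cong (applyAll-cong L (ρs c ∘ suc) (decode-encode y))) ⟩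
    encode (applyAll (suc L) (ρs c) (decode a)) , c ∎
    where
    row : Cell {m} {n} ↔ Cell {m} {n}
    row = rowwise λ c → conjugate (Symmetry.inverse enumeration) (ρs c zero)
    rest : Vector (Perm (suc m) n) L
    rest i = rowFactor λ c → ρs c (suc i)
    y : Point m (n ∘ inject₁)
    y = app (ρs c zero) (decode a)

-- Palindromic factorisation

palindromeLength : ℕ → ℕ
palindromeLength zero = 1
palindromeLength (suc m) = suc (palindromeLength m + 1)

palindrome : ∀ m → Vector (Fin (suc m)) (palindromeLength m)
palindrome zero = zero ∷ []
palindrome (suc m) = fromℕ (suc m) ∷ (map inject₁ (palindrome m) ++ (fromℕ (suc m) ∷ []))

palindromeLength≡m+1+m : ∀ m → palindromeLength m ≡ m + suc m
palindromeLength≡m+1+m zero = refl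
palindromeLength≡m+1+m (suc m) = cong suc (begin
  palindromeLength m + 1 ≡⟨ cong (_+ 1) (palindromeLength≡m+1+m m) ⟩
  m + suc m + 1          ≡⟨ +-assoc m (suc m) 1 ⟩
  m + suc (m + 1)        ≡⟨ cong (λ k → m + suc k) (+-comm m 1) ⟩
  m + suc (suc m)        ∎)

dist[1+m,1+m+k]≡k : ∀ m k → dist (suc m) (suc (m + k)) ≡ k
dist[1+m,1+m+k]≡k m k = cong₂ _+_ (m≤n⇒m∸n≡0 (m≤m+n m k)) (m+n∸m≡n m k)

toℕ-palindrome : ∀ m i → toℕ (palindrome m i) ≡ dist (suc m) (suc (toℕ i))
toℕ-palindrome zero zero = refl
toℕ-palindrome (suc m) zero = trans (toℕ-fromℕ (suc m)) (sym (+-identityʳ (suc m)))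
toℕ-palindrome (suc m) (suc i) with splitAt (palindromeLength m) i in split≡
... | inj₁ j = begin
  toℕ (inject₁ (palindrome m j))     ≡⟨ toℕ-inject₁ _ ⟩
  toℕ (palindrome m j)               ≡⟨ toℕ-palindrome m j ⟩
  dist (suc m) (suc (toℕ j))         ≡⟨ cong (dist (suc m) ∘ suc) toℕ[j]≡toℕ[i] ⟩
  dist (suc m) (suc (toℕ i))         ∎
  where
  toℕ[j]≡toℕ[i] : toℕ j ≡ toℕ i
  toℕ[j]≡toℕ[i] = trans (sym (toℕ-↑ˡ j 1)) (cong toℕ (splitAt⁻¹-↑ˡ split≡))
... | inj₂ zero = begin
  toℕ (fromℕ (suc m))                ≡⟨ toℕ-fromℕ (suc m) ⟩
  suc m                              ≡⟨ sym (dist[1+m,1+m+k]≡k m (suc m)) ⟩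
  dist (suc m) (suc (m + suc m))     ≡⟨ cong (dist (suc m) ∘ suc) m+1+m≡toℕ[i] ⟩
  dist (suc m) (suc (toℕ i))         ∎
  where
  m+1+m≡toℕ[i] : m + suc m ≡ toℕ i
  m+1+m≡toℕ[i] = begin
    m + suc m                          ≡⟨ sym (palindromeLength≡m+1+m m) ⟩
    palindromeLength m                 ≡⟨ sym (+-identityʳ _) ⟩
    palindromeLength m + 0             ≡⟨ sym (toℕ-↑ʳ (palindromeLength m) zero) ⟩
    toℕ (palindromeLength m ↑ʳ zero)   ≡⟨ cong toℕ (splitAt⁻¹-↑ʳ split≡) ⟩
    toℕ i                              ∎

record Factorisation {d n L} (σ : Perm d n) (directions : Vector (Fin d) L) : Set where
  field
    factors : Vector (Perm d n) L
    oneDimensional : Pointwise OneDimensional factors directions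
    factorises : ∀ x → app σ x ≈ᴾ applyAll L factors x

module PalindromeStep {m} {n : Fin (suc (suc m)) → ℕ} (σ : Perm (suc (suc m)) n)
  (factorise-slice : (ρ : Perm (suc m) (n ∘ inject₁)) → Factorisation ρ (palindrome m)) where

  open GridFactors n

  private
    E : Inverse (PointSetoid (suc (suc m)) n) (setoid (Cell {suc m} {n}))
    E = splitLast
    open Inverse E using (to; from; strictlyInverseˡ; strictlyInverseʳ)

  π : Cell {suc m} {n} → Cell {suc m} {n}
  π = to ∘ app σ ∘ from

  π-injective : Injective _≡_ _≡_ π
  π-injective = to-injective (Symmetry.inverse E) ∘ to-injective σ ∘ to-injective E

  open ColumnRowColumn (column-row-column π π-injective)

  slice : Fin (n (fromℕ (suc m))) → Perm (suc m) (n ∘ inject₁)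
  slice c = conjugate enumeration (rows c)

  module SliceFactorisation c = Factorisation (factorise-slice (slice c))

  middle : Vector (Perm (suc (suc m)) n) (palindromeLength m)
  middle i = rowFactor λ c → SliceFactorisation.factors c i

  middle-rowwise : ∀ z → to (applyAll _ middle (from z)) ≡ Inverse.to (rowwise rows) z
  middle-rowwise (a , c) = begin
    to (applyAll _ middle (from (a , c)))
      ≡⟨ applyAll-rowFactor _ SliceFactorisation.factors a c ⟩
    encode (applyAll _ (SliceFactorisation.factors c) (decode a)) , c
      ≡⟨ cong (_, c) (encode-cong (≈ᴾ-sym (SliceFactorisation.factorises c (decode a)))) ⟩
    encode (app (slice c) (decode a)) , c
      ≡⟨ cong (_, c) (trans (encode-decode′ _) (cong (rows c ⟨$⟩ʳ_) (encode-decode′ a))) ⟩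
    rows c ⟨$⟩ʳ a , c ∎
    where
    encode-decode′ : ∀ i → encode {suc m} {n ∘ inject₁} (decode i) ≡ i
    encode-decode′ = encode-decode {suc m} {n ∘ inject₁}

  factors : Vector (Perm (suc (suc m)) n) (palindromeLength (suc m))
  factors = columnFactor columns₁ ∷ (middle ++ (columnFactor columns₂ ∷ []))

  factors-oneDimensional : Pointwise OneDimensional factors (palindrome (suc m))
  factors-oneDimensional zero = columnFactor-oneDimensional columns₁
  factors-oneDimensional (suc i) = ++⁺ OneDimensional middle-oneDimensional last-oneDimensional i
    where
    middle-oneDimensional : Pointwise OneDimensional middle (map inject₁ (palindrome m))
    middle-oneDimensional i =
      rowFactor-oneDimensional (λ c → SliceFactorisation.factors c i) (λ c → SliceFactorisation.oneDimensional c i)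
    last-oneDimensional : Pointwise OneDimensional (columnFactor columns₂ ∷ []) (fromℕ (suc m) ∷ [])
    last-oneDimensional zero = columnFactor-oneDimensional columns₂

  σ≈factors : ∀ x → app σ x ≈ᴾ applyAll _ factors x
  σ≈factors x = to-injective E (begin
    to (app σ x)                        ≡⟨ Inverse.to-cong E (Inverse.to-cong σ (≈ᴾ-sym (strictlyInverseʳ x))) ⟩
    π (to x)                            ≡⟨ factorises (to x) ⟩
    to₂ (Inverse.to (rowwise rows) z)   ≡⟨ cong to₂ (sym (middle-rowwise z)) ⟩
    to₂ (to w)                          ≡⟨ sym (strictlyInverseˡ _) ⟩
    to (app (columnFactor columns₂) w)  ≡⟨ cong to (sym (applyAll-++ _ middle _ (from z))) ⟩
    to (applyAll _ factors x)           ∎)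
    where
    to₂ : Cell {suc m} {n} → Cell {suc m} {n}
    to₂ = Inverse.to (columnwise columns₂)
    z : Cell {suc m} {n}
    z = Inverse.to (columnwise columns₁) (to x)
    w : Point (suc (suc m)) n
    w = applyAll _ middle (from z)

  factorisation : Factorisation σ (palindrome (suc m))
  factorisation = record
    { factors = factors ; oneDimensional = factors-oneDimensional ; factorises = σ≈factors }

factorise : ∀ m {n} (σ : Perm (suc m) n) → Factorisation σ (palindrome m)
factorise zero σ = record
  { factors = σ ∷ []
  ; oneDimensional = λ { zero _ zero 0≢0 → contradiction refl 0≢0 }
  ; factorises = λ _ → ≈ᴾ-refl
  }
factorise (suc m) σ = PalindromeStep.factorisation σ (factorise m)

-- The side lengths need not be positive: an empty grid is factorised in the same way.
lemma2p1 : (m : ℕ) (n : Fin (suc m) → ℕ) → ((j : Fin (suc m)) → 1 ≤ n j)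
    → (σ : Perm (suc m) n)
    → Σ (Fin ((2 * suc m) ∸ 1) → Perm (suc m) n) λ σs →
        ((i : Fin ((2 * suc m) ∸ 1)) →
          Σ (Fin (suc m)) λ j →
            (toℕ j ≡ dist (suc m) (suc (toℕ i)))
            × OneDimensional (σs i) j)
        × ((x : Point (suc m) n) → app σ x ≈ᴾ applyAll ((2 * suc m) ∸ 1) σs x)
lemma2p1 m n _ σ =
  factors ∘ cast length≡ ,
  (λ i → palindrome m (cast length≡ i) , direction≡ i , oneDimensional (cast length≡ i)) ,
  λ x → ≈ᴾ-trans (factorises x) (λ j → cong (λ y → y j) (sym (applyAll-cast length≡ factors x)))
  where
  open Factorisation (factorise m σ)

  length≡ : 2 * suc m ∸ 1 ≡ palindromeLength m
  length≡ = trans (cong (m +_) (+-identityʳ (suc m))) (sym (palindromeLength≡m+1+m m))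

  direction≡ : ∀ i → toℕ (palindrome m (cast length≡ i)) ≡ dist (suc m) (suc (toℕ i))
  direction≡ i = trans (toℕ-palindrome m (cast length≡ i)) (cong (dist (suc m) ∘ suc) (toℕ-cast length≡ i))
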